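{- Let $G=(V,E)$ be a finite regular bipartite graph of degree $r>0$ and let $d^G$ be its graph distance. A set $C\subset V$ is a $1'$-perfect code if and only if $|C|=|V|/2r$ and $d^G(\bar c_1,\bar c_2)\ge4$ for all distinct $\bar c_1,\bar c_2\in C$.
   Context: A subset $C\subseteq V$ is called a $1'$-perfect code if there is a partition $V=V_{ev}\cup V_{od}$ of $V$ into two parts of the bipartite graph (each part spanning no edge) such that $C\subseteq V_{ev}$ and every vertex of $V_{od}$ is adjacent to exactly one element of $C$. (Vertices in different connected components are at infinite distance.) -}

module Defs where

open import Data.Nat using (ℕ; zero; suc; _<_)
open import Data.Bool using (Bool; true; false; T; not)
open import Data.Fin using (Fin)
open import Data.Fin.Subset using (Subset; _∈_; _∉_; ∣_∣)
open import Data.Vec using (tabulate)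
open import Data.Product using (Σ; ∃; _×_)
open import Relation.Binary.PropositionalEquality using (_≡_; _≢_)
open import Relation.Nullary using (¬_)

record Graph (n : ℕ) : Set where
  field
    adj   : Fin n → Fin n → Bool
    sym   : ∀ u v → adj u v ≡ adj v u
    loopless : ∀ v → adj v v ≡ false

open Graph public

Adj : ∀ {n} → Graph n → Fin n → Fin n → Set
Adj G u v = T (adj G u v)

nbhd : ∀ {n} → Graph n → Fin n → Subset n
nbhd G v = tabulate (adj G v)

degree : ∀ {n} → Graph n → Fin n → ℕ
degree G v = ∣ nbhd G v ∣

Regular : ∀ {n} → Graph n → ℕ → Set
Regular G r = ∀ v → degree G v ≡ r

-- A partition V = V_ev ∪ V_od is encoded by a colouring part : V → Bool,
-- with V_ev = { v | part v ≡ true } and V_od = { v | part v ≡ false }.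
-- It is a bipartition if neither part spans an edge.
IsBipartition : ∀ {n} → Graph n → (Fin n → Bool) → Set
IsBipartition G part = ∀ u v → Adj G u v → part u ≢ part v

Bipartite : ∀ {n} → Graph n → Set
Bipartite G = ∃ λ part → IsBipartition G part

AdjExactlyOne : ∀ {n} → Graph n → Subset n → Fin n → Set
AdjExactlyOne G C v =
  ∃ λ c → c ∈ C × Adj G v c × (∀ c′ → c′ ∈ C → Adj G v c′ → c′ ≡ c)

IsOnePrimePerfectCode : ∀ {n} → Graph n → Subset n → Set
IsOnePrimePerfectCode G C =
  ∃ λ part → IsBipartition G part
    × (∀ c → c ∈ C → part c ≡ true)
    × (∀ v → part v ≡ false → AdjExactlyOne G C v)

data Walk {n} (G : Graph n) : Fin n → Fin n → ℕ → Set where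
  here : ∀ {u} → Walk G u u zero
  step : ∀ {u w v m} → Adj G u w → Walk G w v m → Walk G u v (suc m)

-- d^G(u,v) ≥ k : the graph distance (least length of a walk, infinite
-- if u and v lie in different components) is at least k, i.e. there is
-- no walk of length < k from u to v.
DistAtLeast : ∀ {n} → Graph n → ℕ → Fin n → Fin n → Set
DistAtLeast G k u v = ∀ m → m < k → ¬ Walk G u v m

-- Forward: count the edges between C and the odd side. Every codeword is even, so it sends
-- all r of its edges to odd vertices, and every odd vertex receives exactly one, hence
-- |V_od| = r|C|; in a regular bipartite graph |V_ev| = |V_od|, so n = 2r|C|. Walks of
-- length 1 or 3 join vertices on opposite sides, and a walk of length 2 between codewords
-- would give its (odd) middle vertex two neighbours in C.
-- Backward: take V_od to be the vertices adjacent to C. Distance ≥ 3 means each of them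
-- has exactly one neighbour in C, so |V_od| = r|C| = n/2 = |V_ev|. Distance ≥ 4 together
-- with the absence of triangles makes V_od independent, so all r|V_od| = r|V_ev| edges
-- leaving V_od end in V_ev; as no vertex has more than r neighbours in V_od, every even
-- vertex has all its neighbours odd, and V_ev is independent as well.
module Submission where

open import Defs renaming (sym to adj-sym)
open import Data.Nat using (ℕ; zero; suc; _+_; _*_; _≤_; _<_; z≤n; s≤s; _≡ᵇ_; >-nonZero)
open import Data.Nat.Properties
  using ( +-identityʳ; *-identityˡ; *-identityʳ; *-zeroʳ; *-comm; *-assoc; +-cancelʳ-≡; *-cancelʳ-≡
        ; ≤-reflexive; ≤-trans; +-mono-≤; +-mono-<-≤; +-mono-≤-<
        ; *-monoʳ-≤; m≤n⇒m<n∨m≡n; <⇒≢; 1+n≢0; ≡ᵇ⇒≡; ≡⇒≡ᵇ; +-*-semiring; *-commutativeSemigroup )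
open import Algebra.Properties.Semiring.Sum +-*-semiring
  using (sum; sum-cong-≗; sum-replicate-zero; ∑-comm; ∑-distrib-+; *-distribˡ-sum; *-distribʳ-sum)
open import Algebra.Properties.CommutativeSemigroup *-commutativeSemigroup using (x∙yz≈y∙xz)
open import Data.Bool using (Bool; true; false; not; T)
open import Data.Bool.Properties using (¬-not; T-≡)
open import Data.Fin using (Fin; zero; suc; _≟_)
open import Data.Fin.Properties using (suc-injective)
open import Data.Fin.Subset using (Subset; _∈_; ∣_∣)
open import Data.Vec using (_∷_; []; lookup)
open import Data.Vec.Properties using (lookup∘tabulate; []=⇒lookup; lookup⇒[]=)
open import Data.Product using (∃; _×_; _,_)
open import Data.Sum using (inj₁; inj₂)
open import Function using (_∘_)
open import Function.Bundles using (_⇔_; mk⇔; Equivalence)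
open import Relation.Binary.PropositionalEquality
open import Relation.Nullary using (¬_; yes; no; contradiction)

not≡true⇒false : ∀ {b} → not b ≡ true → b ≡ false
not≡true⇒false {false} _ = refl

2*m*n≡n*m+n*m : ∀ m n → 2 * m * n ≡ n * m + n * m
2*m*n≡n*m+n*m m n = begin
  2 * m * n            ≡⟨ *-assoc 2 m n ⟩
  2 * (m * n)          ≡⟨ cong (2 *_) (*-comm m n) ⟩
  n * m + (n * m + 0)  ≡⟨ cong (n * m +_) (+-identityʳ (n * m)) ⟩
  n * m + n * m        ∎
  where open ≡-Reasoning

𝟙 : Bool → ℕ
𝟙 true  = 1
𝟙 false = 0

𝟙≡1⇒true : ∀ {b} → 𝟙 b ≡ 1 → b ≡ true
𝟙≡1⇒true {true} _ = refl

𝟙*𝟙≡0 : ∀ a b → (a ≡ true → ¬ b ≡ true) → 𝟙 a * 𝟙 b ≡ 0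
𝟙*𝟙≡0 true  true  ¬both = contradiction refl (¬both refl)
𝟙*𝟙≡0 true  false _     = refl
𝟙*𝟙≡0 false _     _     = refl

𝟙*𝟙≢0 : ∀ a b → 𝟙 a * 𝟙 b ≢ 0 → a ≡ true × b ≡ true
𝟙*𝟙≢0 true  true  _   = refl , refl
𝟙*𝟙≢0 true  false ≢0 = contradiction refl ≢0
𝟙*𝟙≢0 false _     ≢0 = contradiction refl ≢0

𝟙-+-not : ∀ b → 𝟙 b + 𝟙 (not b) ≡ 1
𝟙-+-not true  = refl
𝟙-+-not false = refl

𝟙-*-≤ : ∀ b m → 𝟙 b * m ≤ m
𝟙-*-≤ true  m = ≤-reflexive (*-identityˡ m)
𝟙-*-≤ false m = z≤n

sum-zero : ∀ {n} {f : Fin n → ℕ} → (∀ i → f i ≡ 0) → sum f ≡ 0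
sum-zero {n} f≗0 = trans (sum-cong-≗ f≗0) (sum-replicate-zero n)

sum-ones : ∀ n → sum {n} (λ _ → 1) ≡ n
sum-ones zero    = refl
sum-ones (suc n) = cong suc (sum-ones n)

sum-single : ∀ {n} {f : Fin n → ℕ} (j : Fin n) → (∀ i → i ≢ j → f i ≡ 0) → sum f ≡ f j
sum-single {f = f} zero    f≡0 = trans (cong (f zero +_) (sum-zero (λ i → f≡0 (suc i) λ ()))) (+-identityʳ _)
sum-single {f = f} (suc j) f≡0 =
  cong₂ _+_ (f≡0 zero λ ()) (sum-single j (λ i i≢j → f≡0 (suc i) (i≢j ∘ suc-injective)))

sum≢0⇒∃≢0 : ∀ {n} (f : Fin n → ℕ) → sum f ≢ 0 → ∃ λ i → f i ≢ 0
sum≢0⇒∃≢0 {zero}  f sum≢0 = contradiction refl sum≢0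
sum≢0⇒∃≢0 {suc n} f sum≢0 with f zero in f₀≡
... | suc _ = zero , λ f₀≡0 → 1+n≢0 (trans (sym f₀≡) f₀≡0)
... | zero with sum≢0⇒∃≢0 (f ∘ suc) sum≢0
...   | i , fi≢0 = suc i , fi≢0

sum-mono-≤ : ∀ {n} {f g : Fin n → ℕ} → (∀ i → f i ≤ g i) → sum f ≤ sum g
sum-mono-≤ {zero}  f≤g = z≤n
sum-mono-≤ {suc n} f≤g = +-mono-≤ (f≤g zero) (sum-mono-≤ (f≤g ∘ suc))

sum-mono-< : ∀ {n} {f g : Fin n → ℕ} → (∀ i → f i ≤ g i) → ∀ j → f j < g j → sum f < sum g
sum-mono-< f≤g zero    fj<gj = +-mono-<-≤ fj<gj (sum-mono-≤ (f≤g ∘ suc))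
sum-mono-< f≤g (suc j) fj<gj = +-mono-≤-< (f≤g zero) (sum-mono-< (f≤g ∘ suc) j fj<gj)

sum-tight : ∀ {n} {f g : Fin n → ℕ} → (∀ i → f i ≤ g i) → sum f ≡ sum g → ∀ i → f i ≡ g i
sum-tight f≤g Σf≡Σg i with m≤n⇒m<n∨m≡n (f≤g i)
... | inj₁ fi<gi = contradiction Σf≡Σg (<⇒≢ (sum-mono-< f≤g i fi<gi))
... | inj₂ fi≡gi = fi≡gi

module _ {n : ℕ} where

  size : (Fin n → Bool) → ℕ
  size A = sum (𝟙 ∘ A)

  sumOver : (Fin n → Bool) → (Fin n → ℕ) → ℕ
  sumOver A f = sum (λ v → 𝟙 (A v) * f v)

  sumOver-cong : ∀ A {f g} → (∀ v → A v ≡ true → f v ≡ g v) → sumOver A f ≡ sumOver A g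
  sumOver-cong A {f} {g} f≡g = sum-cong-≗ termwise
    where
    termwise : ∀ v → 𝟙 (A v) * f v ≡ 𝟙 (A v) * g v
    termwise v with A v in Av
    ... | true  = cong (_+ 0) (f≡g v Av)
    ... | false = refl

  sumOver-const : ∀ A k → sumOver A (λ _ → k) ≡ size A * k
  sumOver-const A k = sym (*-distribʳ-sum k (𝟙 ∘ A))

  sumOver-all : ∀ f → sumOver (λ _ → true) f ≡ sum f
  sumOver-all f = sum-cong-≗ (λ v → *-identityˡ (f v))

  sumOver-tight : ∀ A {f} k → (∀ v → A v ≡ true → f v ≤ k) → sumOver A f ≡ size A * k →
                  ∀ v → A v ≡ true → f v ≡ k
  sumOver-tight A {f} k f≤k Σf≡ v Av = begin
      f v             ≡⟨ *-identityˡ (f v) ⟨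
      1 * f v         ≡⟨ cong (λ b → 𝟙 b * f v) Av ⟨
      𝟙 (A v) * f v   ≡⟨ sum-tight termwise-≤ (trans Σf≡ (sym (sumOver-const A k))) v ⟩
      𝟙 (A v) * k     ≡⟨ cong (λ b → 𝟙 b * k) Av ⟩
      1 * k           ≡⟨ *-identityˡ k ⟩
      k               ∎
    where
    open ≡-Reasoning
    termwise-≤ : ∀ u → 𝟙 (A u) * f u ≤ 𝟙 (A u) * k
    termwise-≤ u with A u in Au
    ... | true  = *-monoʳ-≤ 1 (f≤k u Au)
    ... | false = z≤n

  size+size-∁ : ∀ A → size A + size (not ∘ A) ≡ n
  size+size-∁ A = begin
    size A + size (not ∘ A)         ≡⟨ ∑-distrib-+ (𝟙 ∘ A) (𝟙 ∘ not ∘ A) ⟨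
    sum (λ v → 𝟙 (A v) + 𝟙 (not (A v))) ≡⟨ sum-cong-≗ (λ v → 𝟙-+-not (A v)) ⟩
    sum {n} (λ _ → 1)               ≡⟨ sum-ones n ⟩
    n                               ∎
    where open ≡-Reasoning

∣p∣≡size : ∀ {n} (p : Subset n) → ∣ p ∣ ≡ size (lookup p)
∣p∣≡size []          = refl
∣p∣≡size (true  ∷ p) = cong suc (∣p∣≡size p)
∣p∣≡size (false ∷ p) = ∣p∣≡size p

module _ {n} (G : Graph n) where

  Adj⇒adj : ∀ {v u} → Adj G v u → adj G v u ≡ true
  Adj⇒adj = Equivalence.to T-≡

  adj⇒Adj : ∀ {v u} → adj G v u ≡ true → Adj G v u
  adj⇒Adj = Equivalence.from T-≡

  Adj-sym : ∀ {v u} → Adj G v u → Adj G u v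
  Adj-sym {v} {u} = subst T (adj-sym G v u)

  bipartition-opposite : ∀ {p} → IsBipartition G p → ∀ {v u} → Adj G v u → p v ≡ not (p u)
  bipartition-opposite bip {v} {u} e = ¬-not (bip v u e)

  nbrsIn : (Fin n → Bool) → Fin n → ℕ
  nbrsIn B v = sumOver B (λ u → 𝟙 (adj G v u))

  edges : (Fin n → Bool) → (Fin n → Bool) → ℕ
  edges A B = sumOver A (nbrsIn B)

  edges-comm : ∀ A B → edges A B ≡ edges B A
  edges-comm A B = begin
    sum (λ v → a v * sum (λ u → b u * e v u))    ≡⟨ sum-cong-≗ (λ v → *-distribˡ-sum (a v) (λ u → b u * e v u)) ⟩
    sum (λ v → sum (λ u → a v * (b u * e v u)))  ≡⟨ ∑-comm (λ v u → a v * (b u * e v u)) ⟩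
    sum (λ u → sum (λ v → a v * (b u * e v u)))  ≡⟨ sum-cong-≗ (λ u → sum-cong-≗ (λ v → swap u v)) ⟩
    sum (λ u → sum (λ v → b u * (a v * e u v)))  ≡⟨ sum-cong-≗ (λ u → *-distribˡ-sum (b u) (λ v → a v * e u v)) ⟨
    sum (λ u → b u * sum (λ v → a v * e u v))    ∎
    where
    open ≡-Reasoning
    a b : Fin n → ℕ
    a = 𝟙 ∘ A
    b = 𝟙 ∘ B
    e : Fin n → Fin n → ℕ
    e v u = 𝟙 (adj G v u)
    swap : ∀ u v → a v * (b u * e v u) ≡ b u * (a v * e u v)
    swap u v = trans (x∙yz≈y∙xz (a v) (b u) (e v u)) (cong (λ x → b u * (a v * 𝟙 x)) (adj-sym G v u))

  degree≡sum : ∀ v → degree G v ≡ sum (λ u → 𝟙 (adj G v u))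
  degree≡sum v = trans (∣p∣≡size (nbhd G v)) (sum-cong-≗ (λ u → cong 𝟙 (lookup∘tabulate (adj G v) u)))

  nbrsIn≤degree : ∀ B v → nbrsIn B v ≤ degree G v
  nbrsIn≤degree B v = ≤-trans (sum-mono-≤ (λ u → 𝟙-*-≤ (B u) _)) (≤-reflexive (sym (degree≡sum v)))

  nbrsIn-all : ∀ B v → (∀ u → Adj G v u → B u ≡ true) → nbrsIn B v ≡ degree G v
  nbrsIn-all B v nbrs⊆B = trans (sum-cong-≗ termwise) (sym (degree≡sum v))
    where
    termwise : ∀ u → 𝟙 (B u) * 𝟙 (adj G v u) ≡ 𝟙 (adj G v u)
    termwise u with adj G v u in e
    ... | false = *-zeroʳ (𝟙 (B u))
    ... | true  = cong (λ b → 𝟙 b * 1) (nbrs⊆B u (adj⇒Adj e))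

  nbrsIn≡degree⇒⊆ : ∀ B v → nbrsIn B v ≡ degree G v → ∀ u → Adj G v u → B u ≡ true
  nbrsIn≡degree⇒⊆ B v eq u e = 𝟙≡1⇒true (begin
      𝟙 (B u)                    ≡⟨ *-identityʳ _ ⟨
      𝟙 (B u) * 1                ≡⟨ cong (λ x → 𝟙 (B u) * 𝟙 x) (Adj⇒adj e) ⟨
      𝟙 (B u) * 𝟙 (adj G v u)    ≡⟨ sum-tight (λ w → 𝟙-*-≤ (B w) _) (trans eq (degree≡sum v)) u ⟩
      𝟙 (adj G v u)              ≡⟨ cong 𝟙 (Adj⇒adj e) ⟩
      1                          ∎)
    where open ≡-Reasoning

  nbrsIn-none : ∀ B v → (∀ u → Adj G v u → B u ≡ false) → nbrsIn B v ≡ 0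
  nbrsIn-none B v none = sum-zero λ u → 𝟙*𝟙≡0 (B u) (adj G v u) λ Bu e →
    contradiction (trans (sym Bu) (none u (adj⇒Adj e))) λ ()

  nbrsIn-unique : ∀ B v u → Adj G v u → B u ≡ true →
                  (∀ u′ → Adj G v u′ → B u′ ≡ true → u′ ≡ u) → nbrsIn B v ≡ 1
  nbrsIn-unique B v u e Bu unique =
    trans (sum-single u λ u′ u′≢u → 𝟙*𝟙≡0 (B u′) (adj G v u′) λ Bu′ e′ → u′≢u (unique u′ (adj⇒Adj e′) Bu′))
          (cong₂ (λ x y → 𝟙 x * 𝟙 y) Bu (Adj⇒adj e))

  nbrsIn≢0⇒∃ : ∀ B v → nbrsIn B v ≢ 0 → ∃ λ u → Adj G v u × B u ≡ true
  nbrsIn≢0⇒∃ B v ≢0 with sum≢0⇒∃≢0 _ ≢0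
  ... | u , term≢0 with 𝟙*𝟙≢0 (B u) (adj G v u) term≢0
  ...   | Bu , e = u , adj⇒Adj e , Bu

  exactlyOne⇒nbrsIn≡1 : ∀ {C v} → AdjExactlyOne G C v → nbrsIn (lookup C) v ≡ 1
  exactlyOne⇒nbrsIn≡1 {C} (c , c∈C , e , unique) =
    nbrsIn-unique (lookup C) _ c e ([]=⇒lookup c∈C) λ c′ e′ Cc′ → unique c′ (lookup⇒[]= c′ C Cc′) e′

  NbrsWithin : (Fin n → Bool) → (Fin n → Bool) → Set
  NbrsWithin A B = ∀ v → A v ≡ true → ∀ u → Adj G v u → B u ≡ true

  bipartition-even⇒odd : ∀ {p} → IsBipartition G p → NbrsWithin p (not ∘ p)
  bipartition-even⇒odd bip v pv u e = trans (sym (bipartition-opposite bip e)) pv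

  bipartition-odd⇒even : ∀ {p} → IsBipartition G p → NbrsWithin (not ∘ p) p
  bipartition-odd⇒even bip v ¬pv u e = trans (bipartition-opposite bip (Adj-sym e)) ¬pv

module _ {n r} (G : Graph n) (reg : Regular G r) where

  edges-within : ∀ {A B} → NbrsWithin G A B → edges G A B ≡ size A * r
  edges-within {A} {B} A⟶B =
    trans (sumOver-cong A λ v Av → trans (nbrsIn-all G B v (A⟶B v Av)) (reg v)) (sumOver-const A r)

  bipartition-balanced : 0 < r → ∀ {p} → IsBipartition G p → size p ≡ size (not ∘ p)
  bipartition-balanced 0<r {p} bip = *-cancelʳ-≡ (size p) (size (not ∘ p)) r {{>-nonZero 0<r}} (begin
    size p * r             ≡⟨ edges-within (bipartition-even⇒odd G bip) ⟨
    edges G p (not ∘ p)    ≡⟨ edges-comm G p (not ∘ p) ⟩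
    edges G (not ∘ p) p    ≡⟨ edges-within (bipartition-odd⇒even G bip) ⟩
    size (not ∘ p) * r     ∎)
    where open ≡-Reasoning

module _ {n} (G : Graph n) {C : Subset n} where

  perfect-code-size : ∀ {r} → Regular G r → 0 < r → IsOnePrimePerfectCode G C → 2 * r * ∣ C ∣ ≡ n
  perfect-code-size {r} reg 0<r (p , bip , C⊆even , odd⇒one) = begin
    2 * r * ∣ C ∣             ≡⟨ 2*m*n≡n*m+n*m r ∣ C ∣ ⟩
    ∣ C ∣ * r + ∣ C ∣ * r     ≡⟨ cong₂ _+_ (trans ∣C∣*r≡∣odd∣ (sym (bipartition-balanced G reg 0<r bip))) ∣C∣*r≡∣odd∣ ⟩
    size p + size (not ∘ p)   ≡⟨ size+size-∁ p ⟩
    n                         ∎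
    where
    open ≡-Reasoning
    C⟶odd : NbrsWithin G (lookup C) (not ∘ p)
    C⟶odd c Cc = bipartition-even⇒odd G bip c (C⊆even c (lookup⇒[]= c C Cc))
    ∣C∣*r≡∣odd∣ : ∣ C ∣ * r ≡ size (not ∘ p)
    ∣C∣*r≡∣odd∣ = begin
      ∣ C ∣ * r                        ≡⟨ cong (_* r) (∣p∣≡size C) ⟩
      size (lookup C) * r              ≡⟨ edges-within G reg C⟶odd ⟨
      edges G (lookup C) (not ∘ p)     ≡⟨ edges-comm G (lookup C) (not ∘ p) ⟩
      edges G (not ∘ p) (lookup C)     ≡⟨ sumOver-cong (not ∘ p) (λ v ¬pv → exactlyOne⇒nbrsIn≡1 G (odd⇒one v (not≡true⇒false ¬pv))) ⟩
      sumOver (not ∘ p) (λ _ → 1)      ≡⟨ sumOver-const (not ∘ p) 1 ⟩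
      size (not ∘ p) * 1               ≡⟨ *-identityʳ _ ⟩
      size (not ∘ p)                   ∎

  perfect-code-distance : IsOnePrimePerfectCode G C →
                          ∀ c₁ c₂ → c₁ ∈ C → c₂ ∈ C → c₁ ≢ c₂ → DistAtLeast G 4 c₁ c₂
  perfect-code-distance (p , bip , C⊆even , odd⇒one) c₁ c₂ c₁∈C c₂∈C c₁≢c₂ = no-walk
    where
    even₁ : p c₁ ≡ true
    even₁ = C⊆even c₁ c₁∈C
    even₂ : p c₂ ≡ true
    even₂ = C⊆even c₂ c₂∈C
    no-walk : ∀ m → m < 4 → ¬ Walk G c₁ c₂ m
    no-walk _ _ here = c₁≢c₂ refl
    no-walk _ _ (step e here) = bip c₁ c₂ e (trans even₁ (sym even₂))
    no-walk _ _ (step {w = w} e₁ (step e₂ here))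
      with odd⇒one w (not≡true⇒false (bipartition-even⇒odd G bip c₁ even₁ w e₁))
    ... | c , _ , _ , unique = c₁≢c₂ (trans (unique c₁ c₁∈C (Adj-sym G e₁)) (sym (unique c₂ c₂∈C e₂)))
    no-walk _ _ (step {w = w₁} e₁ (step {w = w₂} e₂ (step e₃ here))) =
      bip w₂ c₂ e₃ (trans (bipartition-odd⇒even G bip w₁ (bipartition-even⇒odd G bip c₁ even₁ w₁ e₁) w₂ e₂) (sym even₂))
    no-walk _ (s≤s (s≤s (s≤s (s≤s ())))) (step _ (step _ (step _ (step _ _))))

module CodeFromDistance
  {n r} (G : Graph n) (reg : Regular G r) {q} (bip-q : IsBipartition G q) {C : Subset n}
  (2r∣C∣≡n : 2 * r * ∣ C ∣ ≡ n)
  (far : ∀ c₁ c₂ → c₁ ∈ C → c₂ ∈ C → c₁ ≢ c₂ → DistAtLeast G 4 c₁ c₂)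
  where

  C-nbrs : Fin n → ℕ
  C-nbrs = nbrsIn G (lookup C)

  even : Fin n → Bool
  even v = C-nbrs v ≡ᵇ 0

  even⇒C-nbrs≡0 : ∀ {v} → even v ≡ true → C-nbrs v ≡ 0
  even⇒C-nbrs≡0 ev = ≡ᵇ⇒≡ _ 0 (Equivalence.from T-≡ ev)

  C-nbrs≡0⇒even : ∀ {v} → C-nbrs v ≡ 0 → even v ≡ true
  C-nbrs≡0⇒even ≡0 = Equivalence.to T-≡ (≡⇒≡ᵇ _ 0 ≡0)

  odd⇒C-nbrs≢0 : ∀ {v} → even v ≡ false → C-nbrs v ≢ 0
  odd⇒C-nbrs≢0 od ≡0 = contradiction (trans (sym od) (C-nbrs≡0⇒even ≡0)) λ ()

  C-nonadjacent : ∀ {c c′} → c ∈ C → c′ ∈ C → ¬ Adj G c c′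
  C-nonadjacent {c} {c′} c∈C c′∈C e with c ≟ c′
  ... | yes refl = contradiction (trans (sym (Adj⇒adj G e)) (loopless G c)) λ ()
  ... | no c≢c′  = far c c′ c∈C c′∈C c≢c′ 1 (s≤s (s≤s z≤n)) (step e here)

  C-nbr-unique : ∀ {v c c′} → Adj G v c → Adj G v c′ → c ∈ C → c′ ∈ C → c′ ≡ c
  C-nbr-unique {c = c} {c′} e e′ c∈C c′∈C with c′ ≟ c
  ... | yes c′≡c = c′≡c
  ... | no c′≢c  = contradiction (step (Adj-sym G e′) (step e here))
                     (far c′ c c′∈C c∈C c′≢c 2 (s≤s (s≤s (s≤s z≤n))))

  C⊆even : ∀ c → c ∈ C → even c ≡ true
  C⊆even c c∈C = C-nbrs≡0⇒even (nbrsIn-none G (lookup C) c λ u e →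
    ¬-not λ Cu → C-nonadjacent c∈C (lookup⇒[]= u C Cu) e)

  odd⇒exactlyOne : ∀ {v} → even v ≡ false → AdjExactlyOne G C v
  odd⇒exactlyOne od with nbrsIn≢0⇒∃ G (lookup C) _ (odd⇒C-nbrs≢0 od)
  ... | c , e , Cc = c , lookup⇒[]= c C Cc , e , λ c′ c′∈C e′ → C-nbr-unique e e′ (lookup⇒[]= c C Cc) c′∈C

  odd-independent : ∀ {u w} → even u ≡ false → even w ≡ false → ¬ Adj G u w
  odd-independent {u} {w} odu odw e with odd⇒exactlyOne odu | odd⇒exactlyOne odw
  ... | c₁ , c₁∈C , e₁ , _ | c₂ , c₂∈C , e₂ , _ with c₁ ≟ c₂
  ...   | yes refl = bip-q u w e (trans (bipartition-opposite G bip-q e₁) (sym (bipartition-opposite G bip-q e₂)))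
  ...   | no c₁≢c₂ = far c₁ c₂ c₁∈C c₂∈C c₁≢c₂ 3 (s≤s (s≤s (s≤s (s≤s z≤n))))
                       (step (Adj-sym G e₁) (step e (step e₂ here)))

  𝟙odd≡C-nbrs : ∀ v → 𝟙 (not (even v)) ≡ C-nbrs v
  𝟙odd≡C-nbrs v with even v in ev
  ... | true  = sym (even⇒C-nbrs≡0 ev)
  ... | false = sym (exactlyOne⇒nbrsIn≡1 G (odd⇒exactlyOne ev))

  size-odd : size (not ∘ even) ≡ ∣ C ∣ * r
  size-odd = begin
    size (not ∘ even)                   ≡⟨ sum-cong-≗ 𝟙odd≡C-nbrs ⟩
    sum C-nbrs                          ≡⟨ sumOver-all C-nbrs ⟨
    edges G (λ _ → true) (lookup C)     ≡⟨ edges-comm G (λ _ → true) (lookup C) ⟩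
    edges G (lookup C) (λ _ → true)     ≡⟨ edges-within G reg (λ _ _ _ _ → refl) ⟩
    size (lookup C) * r                 ≡⟨ cong (_* r) (∣p∣≡size C) ⟨
    ∣ C ∣ * r                           ∎
    where open ≡-Reasoning

  size-even : size even ≡ size (not ∘ even)
  size-even = +-cancelʳ-≡ (size (not ∘ even)) (size even) (size (not ∘ even)) (begin
    size even + size (not ∘ even)            ≡⟨ size+size-∁ even ⟩
    n                                        ≡⟨ 2r∣C∣≡n ⟨
    2 * r * ∣ C ∣                            ≡⟨ 2*m*n≡n*m+n*m r ∣ C ∣ ⟩
    ∣ C ∣ * r + ∣ C ∣ * r                    ≡⟨ cong₂ _+_ size-odd size-odd ⟨
    size (not ∘ even) + size (not ∘ even)    ∎)
    where open ≡-Reasoning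

  odd⟶even : NbrsWithin G (not ∘ even) even
  odd⟶even v odv u e = ¬-not λ odu → odd-independent (not≡true⇒false odv) odu e

  even⟶odd : NbrsWithin G even (not ∘ even)
  even⟶odd v ev = nbrsIn≡degree⇒⊆ G (not ∘ even) v (trans odd-nbrs≡r (sym (reg v)))
    where
    odd-nbrs≡r : nbrsIn G (not ∘ even) v ≡ r
    odd-nbrs≡r = sumOver-tight even r
      (λ u _ → ≤-trans (nbrsIn≤degree G (not ∘ even) u) (≤-reflexive (reg u)))
      (begin
        edges G even (not ∘ even)    ≡⟨ edges-comm G even (not ∘ even) ⟩
        edges G (not ∘ even) even    ≡⟨ edges-within G reg odd⟶even ⟩
        size (not ∘ even) * r        ≡⟨ cong (_* r) size-even ⟨
        size even * r                ∎)
      v ev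
      where open ≡-Reasoning

  even-odd-bipartition : IsBipartition G even
  even-odd-bipartition u w e _ with even u in evu | even w in evw
  ... | false | false = odd-independent evu evw e
  ... | true  | true  = contradiction (trans (sym evw) (not≡true⇒false (even⟶odd u evu w e))) λ ()

  perfect-code : IsOnePrimePerfectCode G C
  perfect-code = even , even-odd-bipartition , C⊆even , λ v → odd⇒exactlyOne

proposition3 : (n r : ℕ) → (G : Graph n) → 0 < r → Regular G r → Bipartite G →
    (C : Subset n) →
    IsOnePrimePerfectCode G C ⇔
      ((2 * r * ∣ C ∣ ≡ n) ×
       (∀ c₁ c₂ → c₁ ∈ C → c₂ ∈ C → c₁ ≢ c₂ → DistAtLeast G 4 c₁ c₂))
proposition3 n r G 0<r reg (q , bip-q) C = mk⇔
  (λ code → perfect-code-size G reg 0<r code , perfect-code-distance G code)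
  (λ (2r∣C∣≡n , far) → CodeFromDistance.perfect-code G reg bip-q 2r∣C∣≡n far)
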